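{- Let $2\leq w<\omega$ and $1\leq c<\omega$. If $(X;\overline E)$ is an $(I,cw)$-special $h$-structure and $f:X\to c$, then there is $Y\subseteq X$ such that $f$ is constant on $Y$ and $Y$ induces an $(I,w)$-special $h$-substructure of $(X;\overline E)$.
   Context: Each $n<\omega$ is identified with $\{0,\dots,n-1\}$. For $1\leq h<\omega$, an $h$-structure $(X;\overline E)=(X;E_0,\dots,E_{h-1})$ consists of a nonempty finite set $X$ and equivalence relations $E_i$ on $X$ ($i<h$) with $E_0=X\times X$ and $E_i\supseteq E_{i+1}$ for $i<h-1$; by convention $E_h$ denotes the identity (discrete) relation on $X$. For $\varnothing\neq Y\subseteq X$, $Y$ induces the $h$-substructure $(Y;E_0\cap Y^2,\dots,E_{h-1}\cap Y^2)$. The $h$-structure is $(I,w)$-special if $w\geq 2$ and: (i) $I=\{i<h: E_i$ is not discrete and $i=\max\{j<h:E_j=E_i\}\}$; (ii) for every $i\in I$ and every $E_i$-class $A$, the number of $E_{i+1}$-classes contained in $A$ is at least $w$. -}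

module Defs where

open import Data.Nat using (ℕ; zero; suc; _≤_; _<_; _*_)
open import Data.Nat.Properties using (_<?_)
open import Data.Fin using (Fin; toℕ; fromℕ<)
open import Data.Bool using (Bool; true; false)
open import Data.Product using (Σ; _×_; _,_; ∃; ∃-syntax)
open import Relation.Nullary using (¬_; yes; no)
open import Relation.Binary.PropositionalEquality using (_≡_; _≢_)

-- An h-structure (X; E_0,...,E_{h-1}) with X = Fin n (a nonempty finite set)
-- and each E_i a (Boolean-valued, hence decidable) equivalence relation on X.
record HStructure (h : ℕ) : Set where
  field
    h≥1       : 1 ≤ h
    n         : ℕ
    nonempty  : 0 < n
    E         : Fin h → Fin n → Fin n → Bool
    E-refl    : ∀ i x → E i x x ≡ true
    E-sym     : ∀ i x y → E i x y ≡ true → E i y x ≡ true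
    E-trans   : ∀ i x y z → E i x y ≡ true → E i y z ≡ true → E i x z ≡ true
    E₀-total  : ∀ (i : Fin h) → toℕ i ≡ 0 → ∀ x y → E i x y ≡ true
    E-chain   : ∀ (i j : Fin h) → suc (toℕ i) ≡ toℕ j →
                ∀ x y → E j x y ≡ true → E i x y ≡ true

module _ {h : ℕ} (S : HStructure h) where
  open HStructure S

  -- E_k for k ≤ h, with the convention that E_h is the identity relation.
  Ê : ℕ → Fin n → Fin n → Set
  Ê k x y with k <? h
  ... | yes p = E (fromℕ< p) x y ≡ true
  ... | no _  = x ≡ y

  Subset : Set
  Subset = Fin n → Bool

  _∈_ : Fin n → Subset → Set
  x ∈ Y = Y x ≡ true

  NotDiscreteOn : Subset → Fin h → Set
  NotDiscreteOn Y i = ∃[ x ] ∃[ y ] (x ∈ Y × y ∈ Y × x ≢ y × E i x y ≡ true)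

  SameOn : Subset → Fin h → Fin h → Set
  SameOn Y i j = ∀ x y → x ∈ Y → y ∈ Y →
                   (E i x y ≡ true → E j x y ≡ true) × (E j x y ≡ true → E i x y ≡ true)

  -- i = max { j < h : E_j ∩ Y² = E_i ∩ Y² }   (i itself belongs to this set)
  IsMaxOn : Subset → Fin h → Set
  IsMaxOn Y i = ∀ (j : Fin h) → toℕ i < toℕ j → ¬ SameOn Y i j

  -- The substructure induced by Y is (I,w)-special, where I ⊆ h is given
  -- by its characteristic function.
  --  (i)  I = { i < h : E_i∩Y² not discrete and i = max{j : E_j∩Y² = E_i∩Y²} }
  --  (ii) for i ∈ I and every E_i-class A (of the substructure, i.e. the class
  --       in Y of some x ∈ Y), A contains at least w E_{i+1}-classes; i.e.
  --       there are w elements of A which are pairwise E_{i+1}-inequivalent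
  --       (an injection of w into the set of E_{i+1}-classes inside A).
  SpecialOn : Subset → (Fin h → Bool) → ℕ → Set
  SpecialOn Y I w =
      2 ≤ w
    × (∀ i → I i ≡ true → NotDiscreteOn Y i × IsMaxOn Y i)
    × (∀ i → NotDiscreteOn Y i → IsMaxOn Y i → I i ≡ true)
    × (∀ i → I i ≡ true → ∀ x → x ∈ Y →
         Σ (Fin w → Fin n) λ a →
             (∀ k → a k ∈ Y)
           × (∀ k → E i x (a k) ≡ true)
           × (∀ k l → k ≢ l → ¬ Ê (suc (toℕ i)) (a k) (a l)))

  -- Y is nonempty (so that it induces an h-substructure).
  NonemptySubset : Subset → Set
  NonemptySubset Y = ∃[ x ] x ∈ Y

  Special : (Fin h → Bool) → ℕ → Set
  Special I w = SpecialOn (λ _ → true) I w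

module Submission where

-- By downward induction on the level k ≤ h we build, for every x, a nonempty
-- monochromatic subset of the E_k-class of x that is w-branching at every level
-- i ≥ k of I.  At level h the singleton {x} works and levels outside I change
-- nothing.  At a level i ∈ I, (I,cw)-speciality gives cw pairwise
-- E_{i+1}-inequivalent points of the E_i-class of x; by pigeonhole w of the sets
-- built for them at level i+1 share a colour, and their union is the new set.
-- Clause (i) for the final set Y follows because two points witnessing branching
-- at i ∈ I show that E_i is not discrete on Y and differs there from every finer
-- E_j, while the converse inclusion is inherited from X.

open import Defs

open import Data.Bool using (Bool; true; false)
open import Data.Bool.ListAction using (any)
open import Data.Bool.Properties using (T-≡)
open import Data.Empty using (⊥-elim)
open import Data.Fin using (Fin; zero; suc; toℕ; fromℕ<; inject≤)
open import Data.Fin.Induction using (>-weakInduction)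
open import Data.Fin.Properties
  using (toℕ<n; toℕ-fromℕ<; fromℕ<-toℕ; toℕ-injective; inject≤-injective; toℕ-fromℕ; toℕ-inject₁)
  renaming (_≟_ to _≟ᶠ_)
open import Data.List using (List; []; _∷_; length; filter; lookup; tabulate)
open import Data.List.Properties using (length-tabulate)
open import Data.List.Membership.Propositional using (lose; find) renaming (_∈_ to _∈ₗ_)
open import Data.List.Membership.Propositional.Properties using (∈-lookup)
open import Data.List.Relation.Unary.All as All using (All; _∷_)
import Data.List.Relation.Unary.All.Properties as All
open import Data.List.Relation.Unary.AllPairs using (AllPairs; _∷_)
import Data.List.Relation.Unary.AllPairs.Properties as AllPairs
open import Data.List.Relation.Unary.Any.Properties using (any⁺; any⁻)
import Data.List.Relation.Binary.Sublist.Propositional.Properties as Sublist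
open import Data.Nat
  using (ℕ; zero; suc; pred; _+_; _*_; _≤_; _<_; s≤s; z≤n; s≤s⁻¹; _≤′_; ≤′-refl; ≤′-step;
         NonZero; >-nonZero; >-nonZero⁻¹)
open import Data.Nat.Properties
  using (_≟_; _<?_; +-suc; +-cancelˡ-<; +-monoˡ-≤; *-monoʳ-<; suc-pred; ≤∧≢⇒<; ≮⇒≥; n≮0;
         <-≤-trans; <⇒≤; <-irrefl; ≤-trans; ≤-reflexive; ≤⇒≤′; m≤n⇒m<n∨m≡n; module ≤-Reasoning)
open import Data.Product using (Σ; _×_; _,_; proj₁; ∃-syntax; map₂)
open import Data.Sum using (inj₁; inj₂)
open import Function using (id; _∘_; case_of_)
open import Function.Bundles using (Equivalence)
open import Level using (0ℓ)
open import Relation.Binary using (Rel; Symmetric)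
open import Relation.Binary.PropositionalEquality using (_≡_; _≢_; refl; cong; sym; trans; subst)
open import Relation.Nullary using (¬_; yes; no; does)
open import Relation.Nullary.Decidable using (dec-true)
open import Relation.Unary using (Pred; Decidable)
open import Relation.Unary.Properties using (∁?)

module _ {A : Set} where

  length-filter+length-filter-∁ : {P : Pred A 0ℓ} (P? : Decidable P) (xs : List A) →
    length (filter P? xs) + length (filter (∁? P?) xs) ≡ length xs
  length-filter+length-filter-∁ P? [] = refl
  length-filter+length-filter-∁ P? (x ∷ xs) with P? x
  ... | yes _ = cong suc (length-filter+length-filter-∁ P? xs)
  ... | no  _ = trans (+-suc _ _) (cong suc (length-filter+length-filter-∁ P? xs))

  allPairs-lookup : {R : Rel A 0ℓ} → Symmetric R → {xs : List A} → AllPairs R xs →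
    {i j : Fin (length xs)} → i ≢ j → R (lookup xs i) (lookup xs j)
  allPairs-lookup R-sym (_ ∷ _)   {zero}  {zero}  i≢j = ⊥-elim (i≢j refl)
  allPairs-lookup R-sym (Rx ∷ _)  {zero}  {suc j} _   = All.lookup Rx (∈-lookup j)
  allPairs-lookup R-sym (Rx ∷ _)  {suc i} {zero}  _   = R-sym (All.lookup Rx (∈-lookup i))
  allPairs-lookup R-sym (_ ∷ Rxs) {suc i} {suc j} i≢j =
    allPairs-lookup R-sym Rxs (λ i≡j → i≢j (cong suc i≡j))

  module _ (colour : A → ℕ) where

    ColourClass : ℕ → List A → List A
    ColourClass γ = filter (λ x → colour x ≟ γ)

    pigeonhole : ∀ c w {xs} → All (λ x → colour x < c) xs → c * w < length xs →
                 ∃[ γ ] w < length (ColourClass γ xs)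
    pigeonhole zero    w (x<0 ∷ _) _ = ⊥-elim (n≮0 x<0)
    pigeonhole (suc c) w {xs} bounded large with w <? length (ColourClass c xs)
    ... | yes big = c , big
    ... | no small = map₂ (λ big → <-≤-trans big (class-shrinks _)) (pigeonhole c w rest-bounded rest-large)
      where
      rest = filter (∁? (λ x → colour x ≟ c)) xs
      rest-bounded : All (λ x → colour x < c) rest
      rest-bounded = All.map (λ (x<1+c , x≢c) → ≤∧≢⇒< (s≤s⁻¹ x<1+c) x≢c)
                       (All.zip (All.filter⁺ _ bounded , All.all-filter _ xs))
      rest-large : c * w < length rest
      rest-large = +-cancelˡ-< w _ _ (begin-strict
        w + c * w                                               <⟨ large ⟩
        length xs                                               ≡⟨ length-filter+length-filter-∁ _ xs ⟨
        length (ColourClass c xs) + length rest                 ≤⟨ +-monoˡ-≤ _ (≮⇒≥ small) ⟩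
        w + length rest                                         ∎)
        where open ≤-Reasoning
      class-shrinks : ∀ γ → length (ColourClass γ rest) ≤ length (ColourClass γ xs)
      class-shrinks γ = Sublist.length-mono-≤ (Sublist.filter⁺ _ _ (λ { refl → id }) (Sublist.filter-⊆ _ xs))

module _ {h : ℕ} (S : HStructure h) where
  open HStructure S

  Ê-refl : ∀ k x → Ê S k x x
  Ê-refl k x with k <? h
  ... | yes k<h = E-refl (fromℕ< k<h) x
  ... | no  _   = refl

  Ê-sym : ∀ k {x y} → Ê S k x y → Ê S k y x
  Ê-sym k {x} {y} xy with k <? h
  ... | yes k<h = E-sym (fromℕ< k<h) x y xy
  ... | no  _   = sym xy

  Ê-trans : ∀ k {x y z} → Ê S k x y → Ê S k y z → Ê S k x z
  Ê-trans k {x} {y} {z} xy yz with k <? h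
  ... | yes k<h = E-trans (fromℕ< k<h) x y z xy yz
  ... | no  _   = trans xy yz

  E⇒Ê : ∀ i {x y} → E i x y ≡ true → Ê S (toℕ i) x y
  E⇒Ê i {x} {y} xy with toℕ i <? h
  ... | yes i<h rewrite fromℕ<-toℕ i i<h = xy
  ... | no  i≮h = ⊥-elim (i≮h (toℕ<n i))

  Ê⇒E : ∀ i {x y} → Ê S (toℕ i) x y → E i x y ≡ true
  Ê⇒E i {x} {y} xy with toℕ i <? h
  ... | yes i<h rewrite fromℕ<-toℕ i i<h = xy
  ... | no  i≮h = ⊥-elim (i≮h (toℕ<n i))

  Ê-suc : ∀ k {x y} → Ê S (suc k) x y → Ê S k x y
  Ê-suc k {x} {y} xy with k <? h | suc k <? h
  ... | yes k<h | yes k+1<h = E-chain (fromℕ< k<h) (fromℕ< k+1<h)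
                                (trans (cong suc (toℕ-fromℕ< k<h)) (sym (toℕ-fromℕ< k+1<h))) x y xy
  ... | yes k<h | no  _     = subst (λ z → E (fromℕ< k<h) x z ≡ true) xy (E-refl (fromℕ< k<h) x)
  ... | no  k≮h | yes k+1<h = ⊥-elim (k≮h (<⇒≤ k+1<h))
  ... | no  _   | no  _     = xy

  Ê-antitone : ∀ {k l} → k ≤′ l → ∀ {x y} → Ê S l x y → Ê S k x y
  Ê-antitone ≤′-refl        xy = xy
  Ê-antitone (≤′-step k≤′l) xy = Ê-antitone k≤′l (Ê-suc _ xy)

  Branching : Subset S → ℕ → Fin h → Set
  Branching Y w i = ∀ x → Y x ≡ true →
    Σ (Fin w → Fin n) λ a →
        (∀ k → Y (a k) ≡ true)
      × (∀ k → E i x (a k) ≡ true)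
      × (∀ k l → k ≢ l → ¬ Ê S (suc (toℕ i)) (a k) (a l))

  SplitOn : Subset S → Fin h → Set
  SplitOn Y i = ∃[ x ] ∃[ y ]
    (Y x ≡ true × Y y ≡ true × E i x y ≡ true × ¬ Ê S (suc (toℕ i)) x y)

  branching⇒split : ∀ {Y w i x} → 2 ≤ w → Branching Y w i → Y x ≡ true → SplitOn Y i
  branching⇒split {i = i} {x} (s≤s (s≤s z≤n)) branching x∈Y with branching x x∈Y
  ... | a , a∈Y , xEa , a-apart =
    a zero , a (suc zero) , a∈Y zero , a∈Y (suc zero) ,
    E-trans i _ x _ (E-sym i x _ (xEa zero)) (xEa (suc zero)) ,
    a-apart zero (suc zero) (λ ())

  split⇒notDiscrete : ∀ {Y i} → SplitOn Y i → NotDiscreteOn S Y i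
  split⇒notDiscrete {i = i} (x , y , x∈Y , y∈Y , xEy , x≁y) =
    x , y , x∈Y , y∈Y , (λ { refl → x≁y (Ê-refl _ x) }) , xEy

  split⇒isMax : ∀ {Y i} → SplitOn Y i → IsMaxOn S Y i
  split⇒isMax (x , y , x∈Y , y∈Y , xEy , x≁y) j i<j same =
    x≁y (Ê-antitone (≤⇒≤′ i<j) (E⇒Ê j (proj₁ (same x y x∈Y y∈Y) xEy)))

  full : Subset S
  full _ = true

  _⊆_ : Subset S → Subset S → Set
  Y ⊆ Z = ∀ {x} → Y x ≡ true → Z x ≡ true

  notDiscrete-mono : ∀ {Y Z i} → Y ⊆ Z → NotDiscreteOn S Y i → NotDiscreteOn S Z i
  notDiscrete-mono Y⊆Z (x , y , x∈Y , y∈Y , x≢y , xEy) = x , y , Y⊆Z x∈Y , Y⊆Z y∈Y , x≢y , xEy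

  isMax-mono : ∀ {Y Z i} → Y ⊆ Z → IsMaxOn S Y i → IsMaxOn S Z i
  isMax-mono Y⊆Z isMax j i<j sameZ = isMax j i<j (λ x y x∈Y y∈Y → sameZ x y (Y⊆Z x∈Y) (Y⊆Z y∈Y))

  ⋃ : (Fin n → Subset S) → List (Fin n) → Subset S
  ⋃ Ys us y = any (λ u → Ys u y) us

  ∈-⋃⁺ : ∀ Ys {u} us {y} → u ∈ₗ us → Ys u y ≡ true → ⋃ Ys us y ≡ true
  ∈-⋃⁺ Ys us u∈us y∈Yu = Equivalence.to T-≡ (any⁺ _ (lose u∈us (Equivalence.from T-≡ y∈Yu)))

  ∈-⋃⁻ : ∀ Ys us {y} → ⋃ Ys us y ≡ true → ∃[ u ] u ∈ₗ us × Ys u y ≡ true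
  ∈-⋃⁻ Ys us y∈⋃ with find (any⁻ _ us (Equivalence.from T-≡ y∈⋃))
  ... | u , u∈us , y∈Yu = u , u∈us , Equivalence.to T-≡ y∈Yu

  branching-⋃ : ∀ Ys us {w i} → (∀ {u} → u ∈ₗ us → Branching (Ys u) w i) → Branching (⋃ Ys us) w i
  branching-⋃ Ys us branching y y∈⋃ with ∈-⋃⁻ Ys us y∈⋃
  ... | u , u∈us , y∈Yu with branching u∈us y y∈Yu
  ...   | a , a∈Yu , rest = a , (λ k → ∈-⋃⁺ Ys us u∈us (a∈Yu k)) , rest

module Construction {h : ℕ} (S : HStructure h) (I : Fin h → Bool) (c w : ℕ)
  .{{_ : NonZero c}} .{{_ : NonZero w}}
  (widely-branching : ∀ i → I i ≡ true → Branching S (full S) (c * w) i)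
  (f : Fin (HStructure.n S) → Fin c) where
  open HStructure S

  BranchingFrom : Subset S → ℕ → Set
  BranchingFrom Y k = ∀ j → k ≤ toℕ j → I j ≡ true → Branching S Y w j

  branchingFrom-pred : ∀ {Y} i → (I i ≡ true → Branching S Y w i) →
                       BranchingFrom Y (suc (toℕ i)) → BranchingFrom Y (toℕ i)
  branchingFrom-pred i at-i above j i≤j Ij with m≤n⇒m<n∨m≡n i≤j
  ... | inj₁ i<j = above j i<j Ij
  ... | inj₂ i≡j with toℕ-injective i≡j
  ...   | refl = at-i Ij

  record Homogeneous (k : ℕ) (x : Fin n) : Set where
    field
      set           : Subset S
      point         : Fin n
      point∈set     : set point ≡ true
      -- a value of toℕ ∘ f, so that pigeonhole can recurse on the number of colours
      colour        : ℕ
      monochromatic : ∀ {y} → set y ≡ true → toℕ (f y) ≡ colour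
      within-class  : ∀ {y} → set y ≡ true → Ê S k x y
      branching     : BranchingFrom set k

    colour<c : colour < c
    colour<c = subst (_< c) (monochromatic point∈set) (toℕ<n (f point))
  open Homogeneous

  singleton : ∀ {k} → h ≤ k → ∀ x → Homogeneous k x
  singleton {k} h≤k x = record
    { set           = λ y → does (x ≟ᶠ y)
    ; point         = x
    ; point∈set     = dec-true (x ≟ᶠ x) refl
    ; colour        = toℕ (f x)
    ; monochromatic = λ {y} y∈ → cong (toℕ ∘ f) (sym (is-x y∈))
    ; within-class  = λ {y} y∈ → subst (Ê S k x) (is-x y∈) (Ê-refl S k x)
    ; branching     = λ j k≤j _ → ⊥-elim (<-irrefl refl (≤-trans (toℕ<n j) (≤-trans h≤k k≤j)))
    }
    where
    is-x : ∀ {y} → does (x ≟ᶠ y) ≡ true → x ≡ y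
    is-x {y} y∈ with x ≟ᶠ y
    ... | yes x≡y = x≡y

  homogeneous-∉I : ∀ i → I i ≡ false → (∀ u → Homogeneous (suc (toℕ i)) u) → ∀ x → Homogeneous (toℕ i) x
  homogeneous-∉I i Ii≡false H x = record
    { set           = set (H x)
    ; point         = point (H x)
    ; point∈set     = point∈set (H x)
    ; colour        = colour (H x)
    ; monochromatic = monochromatic (H x)
    ; within-class  = λ y∈ → Ê-suc S (toℕ i) (within-class (H x) y∈)
    ; branching     = branchingFrom-pred i (λ Ii → case trans (sym Ii≡false) Ii of λ ()) (branching (H x))
    }

  module Amalgamation (i : Fin h) (H : ∀ u → Homogeneous (suc (toℕ i)) u) (x : Fin n) (γ : ℕ)
    (us : List (Fin n)) (apart : AllPairs (λ u v → ¬ Ê S (suc (toℕ i)) u v) us)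
    (near : All (λ u → E i x u ≡ true) us) (coloured : All (λ u → colour (H u) ≡ γ) us)
    (enough : w ≤ length us) where

    Y : Subset S
    Y = ⋃ S (set ∘ H) us

    piece-near : ∀ {u y} → u ∈ₗ us → set (H u) y ≡ true → E i x y ≡ true
    piece-near {u} {y} u∈us y∈Hu =
      E-trans i x u y (All.lookup near u∈us) (Ê⇒E S i (Ê-suc S _ (within-class (H u) y∈Hu)))

    Y-within-class : ∀ {y} → Y y ≡ true → Ê S (toℕ i) x y
    Y-within-class y∈Y with ∈-⋃⁻ S (set ∘ H) us y∈Y
    ... | u , u∈us , y∈Hu = E⇒Ê S i (piece-near u∈us y∈Hu)

    Y-monochromatic : ∀ {y} → Y y ≡ true → toℕ (f y) ≡ γ
    Y-monochromatic y∈Y with ∈-⋃⁻ S (set ∘ H) us y∈Y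
    ... | u , u∈us , y∈Hu = trans (monochromatic (H u) y∈Hu) (All.lookup coloured u∈us)

    centre : Fin w → Fin n
    centre s = lookup us (inject≤ s enough)

    delegate : Fin w → Fin n
    delegate s = point (H (centre s))

    delegate∈Y : ∀ s → Y (delegate s) ≡ true
    delegate∈Y s = ∈-⋃⁺ S (set ∘ H) us (∈-lookup (inject≤ s enough)) (point∈set (H (centre s)))

    delegates-apart : ∀ s t → s ≢ t → ¬ Ê S (suc (toℕ i)) (delegate s) (delegate t)
    -- Each delegate is E_{i+1}-equivalent to its centre, and the centres are pairwise apart.
    delegates-apart s t s≢t ds∼dt =
      allPairs-lookup (λ u≁v v∼u → u≁v (Ê-sym S _ v∼u)) apart
        (s≢t ∘ inject≤-injective _ _ s t)
        (Ê-trans S _ (within-class (H (centre s)) (point∈set (H (centre s))))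
          (Ê-trans S _ ds∼dt (Ê-sym S _ (within-class (H (centre t)) (point∈set (H (centre t)))))))

    Y-branching-at-i : Branching S Y w i
    Y-branching-at-i y y∈Y =
      delegate , delegate∈Y ,
      (λ s → E-trans i y x (delegate s) (E-sym i x y (Ê⇒E S i (Y-within-class y∈Y)))
                                        (Ê⇒E S i (Y-within-class (delegate∈Y s)))) ,
      delegates-apart

    Y-branching-above-i : BranchingFrom Y (suc (toℕ i))
    Y-branching-above-i j i<j Ij = branching-⋃ S (set ∘ H) us (λ {u} _ → branching (H u) j i<j Ij)

    homogeneous : Homogeneous (toℕ i) x
    homogeneous = record
      { set           = Y
      ; point         = delegate s₀
      ; point∈set     = delegate∈Y s₀
      ; colour        = γ
      ; monochromatic = Y-monochromatic
      ; within-class  = Y-within-class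
      ; branching     = branchingFrom-pred i (λ _ → Y-branching-at-i) Y-branching-above-i
      }
      where
      s₀ : Fin w
      s₀ = fromℕ< (>-nonZero⁻¹ w)

  homogeneous-∈I : ∀ i → I i ≡ true → (∀ u → Homogeneous (suc (toℕ i)) u) → ∀ x → Homogeneous (toℕ i) x
  homogeneous-∈I i Ii H x with widely-branching i Ii x refl
  ... | a , _ , xEa , a-apart with pigeonhole (colour ∘ H) c (pred w) (All.tabulate⁺ (colour<c ∘ H ∘ a)) enough
    where
    enough : c * pred w < length (tabulate a)
    enough = begin-strict
      c * pred w         <⟨ *-monoʳ-< c (≤-reflexive (suc-pred w)) ⟩
      c * w              ≡⟨ length-tabulate a ⟨
      length (tabulate a) ∎
      where open ≤-Reasoning
  ... | γ , big =
    Amalgamation.homogeneous i H x γ (ColourClass (colour ∘ H) γ (tabulate a))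
      (AllPairs.filter⁺ _ (AllPairs.tabulate⁺ (a-apart _ _)))
      (All.filter⁺ _ (All.tabulate⁺ xEa))
      (All.all-filter (λ u → colour (H u) ≟ γ) (tabulate a))
      (subst (_≤ length (ColourClass (colour ∘ H) γ (tabulate a))) (suc-pred w) big)

  homogeneous-pred : ∀ i → (∀ u → Homogeneous (suc (toℕ i)) u) → ∀ x → Homogeneous (toℕ i) x
  homogeneous-pred i with I i in Ii
  ... | true  = homogeneous-∈I i Ii
  ... | false = homogeneous-∉I i Ii

  homogeneous : ∀ (k : Fin (suc h)) x → Homogeneous (toℕ k) x
  homogeneous = >-weakInduction (λ k → ∀ x → Homogeneous (toℕ k) x)
    (singleton (≤-reflexive (sym (toℕ-fromℕ h))))
    (λ i H x → subst (λ k → Homogeneous k x) (sym (toℕ-inject₁ i)) (homogeneous-pred i H x))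

lemma3p3 : (w c h : ℕ) → 2 ≤ w → 1 ≤ c →
    (S : HStructure h) → (I : Fin h → Bool) → Special S I (c * w) →
    (f : Fin (HStructure.n S) → Fin c) →
    Σ (Subset S) λ Y →
        NonemptySubset S Y
      × (∀ x y → _∈_ S x Y → _∈_ S y Y → f x ≡ f y)
      × SpecialOn S Y I w
lemma3p3 w c h 2≤w 1≤c S I (_ , _ , inI , widely-branching) f =
  set , (point , point∈set) ,
  (λ x y x∈Y y∈Y → toℕ-injective (trans (monochromatic x∈Y) (sym (monochromatic y∈Y)))) ,
  2≤w ,
  (λ i Ii → let split = branching⇒split S 2≤w (branching i z≤n Ii) point∈set
            in split⇒notDiscrete S split , split⇒isMax S split) ,
  (λ i notDiscrete isMax → inI i (notDiscrete-mono S (λ _ → refl) notDiscrete) (isMax-mono S (λ _ → refl) isMax)) ,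
  (λ i Ii → branching i z≤n Ii)
  where
  instance
    c≢0 : NonZero c
    c≢0 = >-nonZero 1≤c
    w≢0 : NonZero w
    w≢0 = >-nonZero (<⇒≤ 2≤w)
  open Construction S I c w widely-branching f
  open Homogeneous (homogeneous zero (fromℕ< (HStructure.nonempty S)))
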